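{- Let $n\ge2$ and let $\pi$ be a permutation of size $n$ with $\mathrm{cost}(\pi)=n-1$, and let $\tau=T^{n-2}(\pi)$. Then: (1) there exists $k$ with $1\le k\le n-1$ such that $\mathrm{shadow}_k(\tau)\ne\mathsf{S}^k\mathsf{L}^{n-k}$; (2) for each such $k$, $\mathrm{shadow}_k(\pi)=\mathsf{L}^{n-k}\mathsf{S}^k$; consequently $\pi$ is a skew sum $\sigma\ominus\sigma'$ where $\sigma,\sigma'$ are permutations of sizes $n-k$ and $k$ respectively.
   Context: Falls of a permutation are its maximal decreasing strings of consecutive entries; the flip $T$ reverses every fall in place; $T^m$ is its $m$-fold iterate. $\mathrm{cost}(\pi)=\min\{m\ge0: T^m(\pi)=\mathrm{id}\}$. For $1\le k\le n-1$ and a permutation $\sigma$ of size $n$, $\mathrm{shadow}_k(\sigma)$ is the word over $\{\mathsf{S},\mathsf{L}\}$ obtained from the one-line notation of $\sigma$ by replacing each entry in $\{1,\dots,k\}$ by $\mathsf{S}$ and each entry in $\{k+1,\dots,n\}$ by $\mathsf{L}$. The skew sum $\sigma\ominus\sigma'$ of permutations of sizes $p$ and $q$ is the permutation of size $p+q$ whose first $p$ entries are those of $\sigma$ increased by $q$ and whose last $q$ entries are those of $\sigma'$. -}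

module Defs where

open import Data.Nat using (ℕ; zero; suc; _+_; _∸_; _<ᵇ_; _≤ᵇ_; _≤_; _<_)
open import Data.Bool using (if_then_else_)
open import Data.List using (List; []; _∷_; _++_; map; upTo; replicate)
open import Data.List.Relation.Binary.Permutation.Propositional using (_↭_)
open import Relation.Binary.PropositionalEquality using (_≡_)
open import Relation.Nullary using (¬_)

-- Permutations of size n in one-line notation: lists of naturals that are
-- a rearrangement of 1,2,...,n.
idPerm : ℕ → List ℕ
idPerm n = map suc (upTo n)

IsPerm : ℕ → List ℕ → Set
IsPerm n xs = xs ↭ idPerm n

-- The flip T: reverse every fall (maximal decreasing run of consecutive entries).
-- flipGo h rest ys : the current fall read so far, reversed, is h ∷ rest
-- (h = most recent entry); ys = remaining entries.
flipGo : ℕ → List ℕ → List ℕ → List ℕ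
flipGo h rest [] = h ∷ rest
flipGo h rest (x ∷ ys) =
  if x <ᵇ h then flipGo x (h ∷ rest) ys else (h ∷ rest) ++ flipGo x [] ys

flipT : List ℕ → List ℕ
flipT [] = []
flipT (x ∷ xs) = flipGo x [] xs

flipPow : ℕ → List ℕ → List ℕ
flipPow zero xs = xs
flipPow (suc m) xs = flipT (flipPow m xs)

HasCost : ℕ → List ℕ → ℕ → Set
HasCost n π c = (flipPow c π ≡ idPerm n) × (∀ m → m < c → ¬ (flipPow m π ≡ idPerm n))
  where open import Data.Product using (_×_)

data SL : Set where
  S L : SL

shadow : ℕ → List ℕ → List SL
shadow k σ = map (λ x → if x ≤ᵇ k then S else L) σ

-- skew sum σ ⊖ σ', with q = size of σ'
skewSum : List ℕ → ℕ → List ℕ → List ℕ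
skewSum σ q σ' = map (_+ q) σ ++ σ'

module Submission where

-- Fix a threshold k and look at π only through its k-shadow, a word
-- over {S, L}.  Every fall of π has a shadow of the form L^a S^b, and the flip
-- turns it into S^b L^a; so on shadows T acts by flipping the blocks of a block
-- decomposition.  We attach to each word a potential, its *disorder*: the
-- maximum, over the letters S preceded by at least one L, of the number of L's
-- before it plus the number of S's after it.  The disorder is 0 exactly on
-- sorted words S^i L^j, it is at most n − 2 for every word of length n other
-- than L^{n−k} S^k, and flipping the blocks lowers it by at least one.
-- Hence if shadow_k(π) ≠ L^{n−k} S^k, then shadow_k(T^{n−2} π) is sorted; this
-- is part (2), the skew-sum decomposition being read off from the shadow.
-- Part (1) holds because a permutation all of whose shadows are sorted is the
-- identity, while T^{n−2}(π) ≠ id since cost(π) = n − 1.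

open import Defs
open import Function using (_∘_)
open import Data.Nat
  using (ℕ; zero; suc; _+_; _∸_; _≤_; _<_; _⊔_; pred; z≤n; s≤s; s≤s⁻¹; _<ᵇ_; _≤ᵇ_)
open import Data.Nat.Properties
open import Data.Bool using (true; false; if_then_else_)
open import Data.List
  using (List; []; _∷_; [_]; _++_; replicate; map; applyUpTo; length; filter)
open import Data.List.Properties
  using (++-assoc; ++-identityʳ; map-++; ∷-injectiveˡ; ∷-injectiveʳ; map-∘;
         map-id-local; filter-++; filter-all; filter-none;
         length-filter; length-++; length-replicate; length-map; ≡-dec)
open import Data.List.Relation.Unary.All as All using (All; []; _∷_)
open import Data.List.Relation.Binary.Permutation.Propositional
  using (_↭_; ↭-sym; ↭-trans; ↭-reflexive; ↭-refl; module PermutationReasoning)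
open import Data.List.Relation.Binary.Permutation.Propositional.Properties
  using (map⁺; shift; ++⁺ˡ; ++-comm; ↭-length; All-resp-↭; filter-↭)
open import Data.Product using (_×_; _,_; proj₁; proj₂; ∃-syntax)
open import Data.Sum using (_⊎_; inj₁; inj₂)
open import Data.Unit using (⊤; tt)
open import Data.Empty using (⊥-elim)
open import Relation.Binary using (tri<; tri≈; tri>)
open import Relation.Binary.PropositionalEquality
  using (_≡_; _≢_; refl; sym; trans; cong; cong₂; subst; module ≡-Reasoning)
open import Relation.Nullary using (¬_; Dec; yes; no; ¬?)
open import Relation.Nullary.Decidable using (decidable-stable)
open import Relation.Nullary.Reflects using (ofʸ; ofⁿ)
open import Relation.Unary using (Decidable; ∁)

_≟SL_ : (x y : SL) → Dec (x ≡ y)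
S ≟SL S = yes refl
S ≟SL L = no (λ ())
L ≟SL S = no (λ ())
L ≟SL L = yes refl

S≢L : S ≢ L
S≢L ()

countS : List SL → ℕ
countS w = length (filter (_≟SL S) w)

countS-↭ : ∀ {v w} → v ↭ w → countS v ≡ countS w
countS-↭ p = ↭-length (filter-↭ (_≟SL S) p)

countS-Ls : ∀ a w → countS (replicate a L ++ w) ≡ countS w
countS-Ls zero    w = refl
countS-Ls (suc a) w = countS-Ls a w

countS-only-Ls : ∀ j → countS (replicate j L) ≡ 0
countS-only-Ls zero    = refl
countS-only-Ls (suc j) = countS-only-Ls j

countS-Ss : ∀ b w → countS (replicate b S ++ w) ≡ b + countS w
countS-Ss zero    w = refl
countS-Ss (suc b) w = cong suc (countS-Ss b w)

countS-sorted : ∀ i j → countS (replicate i S ++ replicate j L) ≡ i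
countS-sorted i j = begin
  countS (replicate i S ++ replicate j L)  ≡⟨ countS-Ss i _ ⟩
  i + countS (replicate j L)                ≡⟨ cong (i +_) (countS-only-Ls j) ⟩
  i + 0                                     ≡⟨ +-identityʳ i ⟩
  i                                         ∎
  where open ≡-Reasoning

sorted-word-determined : ∀ {i j k l} →
  replicate i S ++ replicate j L ↭ replicate k S ++ replicate l L → i ≡ k × j ≡ l
sorted-word-determined {i} {j} {k} {l} p = i≡k , +-cancelˡ-≡ k j l (begin
    k + j                                  ≡⟨ cong (_+ j) (sym i≡k) ⟩
    i + j                                  ≡⟨ sym (word-length i j) ⟩
    length (replicate i S ++ replicate j L) ≡⟨ ↭-length p ⟩
    length (replicate k S ++ replicate l L) ≡⟨ word-length k l ⟩
    k + l                                  ∎)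
  where
  open ≡-Reasoning
  word-length : ∀ a b → length (replicate a S ++ replicate b L) ≡ a + b
  word-length a b = trans (length-++ (replicate a S))
                          (cong₂ _+_ (length-replicate a) (length-replicate b))
  i≡k : i ≡ k
  i≡k = trans (sym (countS-sorted i j)) (trans (countS-↭ p) (countS-sorted k l))

-- disorder c w: the parameter c counts the L's already read.
disorder : ℕ → List SL → ℕ
disorder c       []      = 0
disorder c       (L ∷ w) = disorder (suc c) w
disorder zero    (S ∷ w) = disorder zero w
disorder (suc c) (S ∷ w) = (suc c + countS w) ⊔ disorder (suc c) w

disorder-Ls : ∀ a c w → disorder c (replicate a L ++ w) ≡ disorder (a + c) w
disorder-Ls zero    c w = refl
disorder-Ls (suc a) c w = trans (disorder-Ls a (suc c) w) (cong (λ d → disorder d w) (+-suc a c))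

disorder-leading-Ss : ∀ b w → disorder 0 (replicate b S ++ w) ≡ disorder 0 w
disorder-leading-Ss zero    w = refl
disorder-leading-Ss (suc b) w = disorder-leading-Ss b w

disorder-Ss-≥ : ∀ c b w → disorder c w ≤ disorder c (replicate b S ++ w)
disorder-Ss-≥ c       zero    w = ≤-refl
disorder-Ss-≥ zero    (suc b) w = disorder-Ss-≥ zero b w
disorder-Ss-≥ (suc c) (suc b) w = ≤-trans (disorder-Ss-≥ (suc c) b w) (m≤n⊔m _ _)

disorder-Ss-first : ∀ c b w → suc c + (b + countS w) ≤ disorder (suc c) (replicate (suc b) S ++ w)
disorder-Ss-first c b w =
  ≤-trans (≤-reflexive (cong (suc c +_) (sym (countS-Ss b w))))
          (m≤m⊔n _ (disorder (suc c) (replicate b S ++ w)))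

disorder-Ss-≤ : ∀ c b w →
  disorder (suc c) (replicate b S ++ w) ≤ (c + (b + countS w)) ⊔ disorder (suc c) w
disorder-Ss-≤ c zero    w = m≤n⊔m _ _
disorder-Ss-≤ c (suc b) w = ⊔-lub first rest
  where
  first : suc c + countS (replicate b S ++ w) ≤ (c + (suc b + countS w)) ⊔ disorder (suc c) w
  first = ≤-trans (≤-reflexive (trans (cong (suc c +_) (countS-Ss b w)) (sym (+-suc c _))))
                  (m≤m⊔n _ _)
  rest : disorder (suc c) (replicate b S ++ w) ≤ (c + (suc b + countS w)) ⊔ disorder (suc c) w
  rest = ≤-trans (disorder-Ss-≤ c b w) (⊔-monoˡ-≤ _ (+-monoʳ-≤ c (n≤1+n _)))

-- Block words.  A block (a , b) stands for the word L^a S^b, the shadow of a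
-- fall; flipping the fall turns it into S^b L^a.
blocksWord : List (ℕ × ℕ) → List SL
blocksWord []             = []
blocksWord ((a , b) ∷ bs) = replicate a L ++ (replicate b S ++ blocksWord bs)

flippedWord : List (ℕ × ℕ) → List SL
flippedWord []             = []
flippedWord ((a , b) ∷ bs) = replicate b S ++ (replicate a L ++ flippedWord bs)

countS-flippedWord : ∀ bs → countS (flippedWord bs) ≡ countS (blocksWord bs)
countS-flippedWord []             = refl
countS-flippedWord ((a , b) ∷ bs) = begin
  countS (replicate b S ++ replicate a L ++ flippedWord bs) ≡⟨ countS-Ss b _ ⟩
  b + countS (replicate a L ++ flippedWord bs)              ≡⟨ cong (b +_) (countS-Ls a _) ⟩
  b + countS (flippedWord bs)                               ≡⟨ cong (b +_) (countS-flippedWord bs) ⟩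
  b + countS (blocksWord bs)                                ≡⟨ sym (countS-Ss b _) ⟩
  countS (replicate b S ++ blocksWord bs)                   ≡⟨ sym (countS-Ls a _) ⟩
  countS (replicate a L ++ replicate b S ++ blocksWord bs)  ∎
  where open ≡-Reasoning

StartsWithL : List (ℕ × ℕ) → Set
StartsWithL []            = ⊤
StartsWithL ((a , _) ∷ _) = 1 ≤ a

-- The block decompositions arising from falls: a block without S's ends in a
-- large entry, so the next fall starts with a large entry, i.e. with an L.
Admissible : List (ℕ × ℕ) → Set
Admissible []             = ⊤
Admissible ((_ , b) ∷ bs) = (b ≡ 0 → StartsWithL bs) × Admissible bs

-- The contribution of the first letter of w to disorder c w, if that letter is
-- an S preceded by L's.  Flipping the blocks need not lower it, so it is
-- carried separately in the induction below; at the top level (c = 0) it is 0.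
leadingTerm : ℕ → List SL → ℕ
leadingTerm zero    _       = 0
leadingTerm (suc c) []      = 0
leadingTerm (suc c) (L ∷ _) = 0
leadingTerm (suc c) (S ∷ w) = suc c + countS w

leadingTerm-≤ : ∀ c w → leadingTerm (suc c) w ≤ c + countS w
leadingTerm-≤ c []      = z≤n
leadingTerm-≤ c (L ∷ w) = z≤n
leadingTerm-≤ c (S ∷ w) = ≤-reflexive (sym (+-suc c (countS w)))

leadingTerm-startsWithL : ∀ c bs → StartsWithL bs → leadingTerm c (blocksWord bs) ≡ 0
leadingTerm-startsWithL zero    bs                   _ = refl
leadingTerm-startsWithL (suc c) []                   _ = refl
leadingTerm-startsWithL (suc c) ((suc a , b) ∷ bs)   _ = refl

leadingTerm-absorbed : ∀ c a b bs → (b ≡ 0 → StartsWithL bs) →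
  leadingTerm (a + c) (blocksWord bs) ≤ pred (disorder c (blocksWord ((a , b) ∷ bs)))
leadingTerm-absorbed c a zero bs startsL =
  ≤-trans (≤-reflexive (leadingTerm-startsWithL (a + c) bs (startsL refl))) z≤n
leadingTerm-absorbed c a (suc b) bs _ with a + c | disorder-Ls a c (replicate (suc b) S ++ blocksWord bs)
... | zero  | _ = z≤n
... | suc d | e = begin
  leadingTerm (suc d) w                             ≤⟨ leadingTerm-≤ d w ⟩
  d + countS w                                      ≤⟨ +-monoʳ-≤ d (m≤n+m _ b) ⟩
  pred (suc d + (b + countS w))                     ≤⟨ pred-mono-≤ (disorder-Ss-first d b w) ⟩
  pred (disorder (suc d) (replicate (suc b) S ++ w)) ≡⟨ cong pred (sym e) ⟩
  pred (disorder c (blocksWord ((a , suc b) ∷ bs))) ∎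
  where
  open ≤-Reasoning
  w : List SL
  w = blocksWord bs

tail-bound : ∀ c a b bs → (b ≡ 0 → StartsWithL bs) →
  disorder (a + c) (flippedWord bs)
    ≤ pred (disorder (a + c) (blocksWord bs)) ⊔ leadingTerm (a + c) (blocksWord bs) →
  disorder c (replicate a L ++ flippedWord bs) ≤ pred (disorder c (blocksWord ((a , b) ∷ bs)))
tail-bound c a b bs startsL ih = begin
  disorder c (replicate a L ++ flippedWord bs) ≡⟨ disorder-Ls a c _ ⟩
  disorder (a + c) (flippedWord bs)            ≤⟨ ih ⟩
  pred (disorder (a + c) (blocksWord bs)) ⊔ leadingTerm (a + c) (blocksWord bs)
    ≤⟨ ⊔-lub tail-disorder (leadingTerm-absorbed c a b bs startsL) ⟩
  pred (disorder c (blocksWord ((a , b) ∷ bs))) ∎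
  where
  open ≤-Reasoning
  tail-disorder : pred (disorder (a + c) (blocksWord bs)) ≤ pred (disorder c (blocksWord ((a , b) ∷ bs)))
  tail-disorder = pred-mono-≤ (≤-trans (disorder-Ss-≥ (a + c) b (blocksWord bs))
                                       (≤-reflexive (sym (disorder-Ls a c _))))

flipped-S-run : ∀ c a b bs →
  c + (suc b + countS (blocksWord bs))
    ≤ pred (disorder (suc c) (blocksWord ((a , suc b) ∷ bs)))
      ⊔ leadingTerm (suc c) (blocksWord ((a , suc b) ∷ bs))
flipped-S-run c zero b bs = ≤-trans (≤-reflexive is-leading) (m≤n⊔m _ _)
  where
  open ≡-Reasoning
  R : ℕ
  R = countS (blocksWord bs)
  is-leading : c + (suc b + R) ≡ leadingTerm (suc c) (replicate (suc b) S ++ blocksWord bs)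
  is-leading = begin
    c + (suc b + R)                               ≡⟨ +-suc c (b + R) ⟩
    suc c + (b + R)                               ≡⟨ cong (suc c +_) (countS-Ss b _) ⟨
    suc c + countS (replicate b S ++ blocksWord bs) ∎
flipped-S-run c (suc a) b bs = ≤-trans bound (m≤m⊔n _ _)
  where
  open ≤-Reasoning
  R : ℕ
  R = countS (blocksWord bs)
  w : List SL
  w = replicate (suc b) S ++ blocksWord bs
  bound : c + (suc b + R) ≤ pred (disorder (suc c) (replicate (suc a) L ++ w))
  bound = begin
    c + (suc b + R)                         ≡⟨ +-suc c (b + R) ⟩
    suc c + (b + R)                         ≤⟨ m≤n+m _ a ⟩
    a + (suc c + (b + R))                   ≡⟨ sym (+-assoc a (suc c) (b + R)) ⟩
    pred (suc (a + suc c) + (b + R))        ≤⟨ pred-mono-≤ (disorder-Ss-first (a + suc c) b _) ⟩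
    pred (disorder (suc a + suc c) w)       ≡⟨ cong pred (sym (disorder-Ls (suc a) (suc c) w)) ⟩
    pred (disorder (suc c) (replicate (suc a) L ++ w)) ∎

disorder-flippedWord : ∀ c bs → Admissible bs →
  disorder c (flippedWord bs) ≤ pred (disorder c (blocksWord bs)) ⊔ leadingTerm c (blocksWord bs)
disorder-flippedWord c [] _ = z≤n
disorder-flippedWord zero ((a , b) ∷ bs) (startsL , adm) =
  ≤-trans (≤-reflexive (disorder-leading-Ss b _))
          (≤-trans (tail-bound 0 a b bs startsL (disorder-flippedWord (a + 0) bs adm)) (m≤m⊔n _ _))
disorder-flippedWord (suc c) ((a , zero) ∷ bs) (startsL , adm) =
  ≤-trans (tail-bound (suc c) a zero bs startsL (disorder-flippedWord (a + suc c) bs adm)) (m≤m⊔n _ _)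
disorder-flippedWord (suc c) ((a , suc b) ∷ bs) (startsL , adm) =
  ≤-trans (disorder-Ss-≤ c (suc b) _) (⊔-lub S-run rest)
  where
  S-run : c + (suc b + countS (replicate a L ++ flippedWord bs))
          ≤ pred (disorder (suc c) (blocksWord ((a , suc b) ∷ bs)))
            ⊔ leadingTerm (suc c) (blocksWord ((a , suc b) ∷ bs))
  S-run = ≤-trans (≤-reflexive (cong (λ r → c + (suc b + r))
                                     (trans (countS-Ls a _) (countS-flippedWord bs))))
                  (flipped-S-run c a b bs)
  rest : disorder (suc c) (replicate a L ++ flippedWord bs)
         ≤ pred (disorder (suc c) (blocksWord ((a , suc b) ∷ bs)))
           ⊔ leadingTerm (suc c) (blocksWord ((a , suc b) ∷ bs))
  rest = ≤-trans (tail-bound (suc c) a (suc b) bs startsL (disorder-flippedWord (a + suc c) bs adm))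
                 (m≤m⊔n _ _)

letter : ℕ → ℕ → SL
letter k x = if x ≤ᵇ k then S else L

letter-S : ∀ {k x} → x ≤ k → letter k x ≡ S
letter-S {k} {x} x≤k with x ≤ᵇ k | ≤ᵇ-reflects-≤ x k
... | true  | _        = refl
... | false | ofⁿ x≰k = ⊥-elim (x≰k x≤k)

letter-L : ∀ {k x} → k < x → letter k x ≡ L
letter-L {k} {x} k<x with x ≤ᵇ k | ≤ᵇ-reflects-≤ x k
... | true  | ofʸ x≤k = ⊥-elim (<⇒≱ k<x x≤k)
... | false | _        = refl

-- fallBlocks k h a b ys: the block decomposition of the k-shadow of a list whose
-- current fall has shadow L^a S^b so far and ends in h, with ys still to read.
fallBlocks : ℕ → ℕ → ℕ → ℕ → List ℕ → List (ℕ × ℕ)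
fallBlocks k h a b []       = (a , b) ∷ []
fallBlocks k h a b (x ∷ ys) =
  if x <ᵇ h
  then (if x ≤ᵇ k then fallBlocks k x a (suc b) ys else fallBlocks k x (suc a) b ys)
  else ((a , b) ∷ (if x ≤ᵇ k then fallBlocks k x 0 1 ys else fallBlocks k x 1 0 ys))

replicate-snoc : ∀ {A : Set} n (x : A) w → replicate (suc n) x ++ w ≡ replicate n x ++ (x ∷ w)
replicate-snoc zero    x w = refl
replicate-snoc (suc n) x w = cong (x ∷_) (replicate-snoc n x w)

-- The blocks concatenate to the shadow (a fall ending in a large entry has no S).
blocksWord-fallBlocks : ∀ k h a b ys → (k < h → b ≡ 0) →
  blocksWord (fallBlocks k h a b ys) ≡ replicate a L ++ (replicate b S ++ shadow k ys)
blocksWord-fallBlocks k h a b [] _ = refl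
blocksWord-fallBlocks k h a b (x ∷ ys) large⇒noS
  with x <ᵇ h | <ᵇ-reflects-< x h | x ≤ᵇ k | ≤ᵇ-reflects-≤ x k
... | true | _ | true | ofʸ x≤k =
  trans (blocksWord-fallBlocks k x a (suc b) ys (λ k<x → ⊥-elim (<⇒≱ k<x x≤k)))
        (cong (replicate a L ++_) (replicate-snoc b S _))
... | true | ofʸ x<h | false | ofⁿ x≰k with large⇒noS (<-trans (≰⇒> x≰k) x<h)
...   | refl = trans (blocksWord-fallBlocks k x (suc a) 0 ys (λ _ → refl)) (replicate-snoc a L _)
blocksWord-fallBlocks k h a b (x ∷ ys) _ | false | _ | true | ofʸ x≤k =
  cong (λ v → replicate a L ++ (replicate b S ++ v))
       (blocksWord-fallBlocks k x 0 1 ys (λ k<x → ⊥-elim (<⇒≱ k<x x≤k)))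
blocksWord-fallBlocks k h a b (x ∷ ys) _ | false | _ | false | _ =
  cong (λ v → replicate a L ++ (replicate b S ++ v)) (blocksWord-fallBlocks k x 1 0 ys (λ _ → refl))

shadow-closed-fall : ∀ k fall {v w a b} → shadow k fall ≡ replicate b S ++ replicate a L →
  shadow k v ≡ w → shadow k (fall ++ v) ≡ replicate b S ++ (replicate a L ++ w)
shadow-closed-fall k fall {v} {a = a} {b} e e' =
  trans (map-++ _ fall v) (trans (cong₂ _++_ e e') (++-assoc (replicate b S) (replicate a L) _))

shadow-flipGo : ∀ k h rest a b ys → (k < h → b ≡ 0) →
  shadow k (h ∷ rest) ≡ replicate b S ++ replicate a L →
  shadow k (flipGo h rest ys) ≡ flippedWord (fallBlocks k h a b ys)
shadow-flipGo k h rest a b [] _ e = trans e (cong (replicate b S ++_) (sym (++-identityʳ _)))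
shadow-flipGo k h rest a b (x ∷ ys) large⇒noS e
  with x <ᵇ h | <ᵇ-reflects-< x h | x ≤ᵇ k | ≤ᵇ-reflects-≤ x k
... | true | _ | true | ofʸ x≤k =
  shadow-flipGo k x (h ∷ rest) a (suc b) ys (λ k<x → ⊥-elim (<⇒≱ k<x x≤k))
                (cong₂ _∷_ (letter-S x≤k) e)
... | true | ofʸ x<h | false | ofⁿ x≰k with large⇒noS (<-trans (≰⇒> x≰k) x<h)
...   | refl = shadow-flipGo k x (h ∷ rest) (suc a) 0 ys (λ _ → refl)
                             (cong₂ _∷_ (letter-L (≰⇒> x≰k)) e)
shadow-flipGo k h rest a b (x ∷ ys) _ e | false | _ | true | ofʸ x≤k =
  shadow-closed-fall k (h ∷ rest) {a = a} {b} e
    (shadow-flipGo k x [] 0 1 ys (λ k<x → ⊥-elim (<⇒≱ k<x x≤k)) (cong [_] (letter-S x≤k)))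
shadow-flipGo k h rest a b (x ∷ ys) _ e | false | _ | false | ofⁿ x≰k =
  shadow-closed-fall k (h ∷ rest) {a = a} {b} e
    (shadow-flipGo k x [] 1 0 ys (λ _ → refl) (cong [_] (letter-L (≰⇒> x≰k))))

fallBlocks-startsWithL : ∀ k h a b ys → 1 ≤ a → StartsWithL (fallBlocks k h a b ys)
fallBlocks-startsWithL k h a b []       1≤a = 1≤a
fallBlocks-startsWithL k h a b (x ∷ ys) 1≤a with x <ᵇ h | x ≤ᵇ k
... | true  | true  = fallBlocks-startsWithL k x a (suc b) ys 1≤a
... | true  | false = fallBlocks-startsWithL k x (suc a) b ys (m≤n⇒m≤1+n 1≤a)
... | false | _     = 1≤a

-- Fall decompositions are admissible: a fall whose shadow has no S ends in a
-- large entry h, and the next fall starts with an entry x ≥ h, also large.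
fallBlocks-admissible : ∀ k h a b ys → (b ≡ 0 → k < h) → Admissible (fallBlocks k h a b ys)
fallBlocks-admissible k h a b [] _ = (λ _ → tt) , tt
fallBlocks-admissible k h a b (x ∷ ys) noS⇒large
  with x <ᵇ h | <ᵇ-reflects-< x h | x ≤ᵇ k | ≤ᵇ-reflects-≤ x k
... | true  | _        | true  | _        = fallBlocks-admissible k x a (suc b) ys (λ ())
... | true  | _        | false | ofⁿ x≰k = fallBlocks-admissible k x (suc a) b ys (λ _ → ≰⇒> x≰k)
... | false | ofⁿ x≮h | true  | ofʸ x≤k =
      (λ b≡0 → ⊥-elim (<⇒≱ (noS⇒large b≡0) (≤-trans (≮⇒≥ x≮h) x≤k)))
    , fallBlocks-admissible k x 0 1 ys (λ ())
... | false | _        | false | ofⁿ x≰k =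
      (λ _ → fallBlocks-startsWithL k x 1 0 ys ≤-refl)
    , fallBlocks-admissible k x 1 0 ys (λ _ → ≰⇒> x≰k)

disorder-flipGo : ∀ k x ys a b → (k < x → b ≡ 0) → (b ≡ 0 → k < x) →
  shadow k [ x ] ≡ replicate b S ++ replicate a L →
  disorder 0 (shadow k (flipGo x [] ys))
    ≤ pred (disorder 0 (replicate a L ++ (replicate b S ++ shadow k ys)))
disorder-flipGo k x ys a b large⇒noS noS⇒large e = begin
  disorder 0 (shadow k (flipGo x [] ys))
    ≡⟨ cong (disorder 0) (shadow-flipGo k x [] a b ys large⇒noS e) ⟩
  disorder 0 (flippedWord blocks)
    ≤⟨ disorder-flippedWord 0 blocks (fallBlocks-admissible k x a b ys noS⇒large) ⟩
  pred (disorder 0 (blocksWord blocks)) ⊔ 0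
    ≡⟨ ⊔-identityʳ _ ⟩
  pred (disorder 0 (blocksWord blocks))
    ≡⟨ cong (pred ∘ disorder 0) (blocksWord-fallBlocks k x a b ys large⇒noS) ⟩
  pred (disorder 0 (replicate a L ++ (replicate b S ++ shadow k ys))) ∎
  where
  open ≤-Reasoning
  blocks : List (ℕ × ℕ)
  blocks = fallBlocks k x a b ys

disorder-flipT : ∀ k xs → disorder 0 (shadow k (flipT xs)) ≤ pred (disorder 0 (shadow k xs))
disorder-flipT k []       = z≤n
disorder-flipT k (x ∷ ys) with x ≤ᵇ k | ≤ᵇ-reflects-≤ x k
... | true  | ofʸ x≤k =
  disorder-flipGo k x ys 0 1 (λ k<x → ⊥-elim (<⇒≱ k<x x≤k)) (λ ()) (cong [_] (letter-S x≤k))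
... | false | ofⁿ x≰k =
  disorder-flipGo k x ys 1 0 (λ _ → refl) (λ _ → ≰⇒> x≰k) (cong [_] (letter-L (≰⇒> x≰k)))

disorder-flipPow : ∀ k m xs → disorder 0 (shadow k (flipPow m xs)) ≤ disorder 0 (shadow k xs) ∸ m
disorder-flipPow k zero    xs = ≤-refl
disorder-flipPow k (suc m) xs = begin
  disorder 0 (shadow k (flipT (flipPow m xs)))  ≤⟨ disorder-flipT k (flipPow m xs) ⟩
  pred (disorder 0 (shadow k (flipPow m xs)))   ≤⟨ pred-mono-≤ (disorder-flipPow k m xs) ⟩
  pred (disorder 0 (shadow k xs) ∸ m)           ≡⟨ pred[m∸n]≡m∸[1+n] _ m ⟩
  disorder 0 (shadow k xs) ∸ suc m              ∎
  where open ≤-Reasoning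

disorder-S-positive : ∀ c w → 0 < disorder (suc c) (S ∷ w)
disorder-S-positive c w = ≤-trans (s≤s z≤n) (m≤m⊔n (suc c + countS w) (disorder (suc c) w))

disorder-zero⇒all-L : ∀ c w → disorder (suc c) w ≡ 0 → w ≡ replicate (length w) L
disorder-zero⇒all-L c []      _ = refl
disorder-zero⇒all-L c (L ∷ w) e = cong (L ∷_) (disorder-zero⇒all-L (suc c) w e)
disorder-zero⇒all-L c (S ∷ w) e = ⊥-elim (<⇒≢ (disorder-S-positive c w) (sym e))

disorder-zero⇒sorted : ∀ w → disorder 0 w ≡ 0 → ∃[ i ] ∃[ j ] (w ≡ replicate i S ++ replicate j L)
disorder-zero⇒sorted []      _ = 0 , 0 , refl
disorder-zero⇒sorted (S ∷ w) e with disorder-zero⇒sorted w e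
... | i , j , w≡ = suc i , j , cong (S ∷_) w≡
disorder-zero⇒sorted (L ∷ w) e = 0 , suc (length w) , cong (L ∷_) (disorder-zero⇒all-L 0 w e)

all-S-or-fewer : ∀ w → w ≡ replicate (length w) S ⊎ suc (countS w) ≤ length w
all-S-or-fewer []      = inj₁ refl
all-S-or-fewer (L ∷ w) = inj₂ (s≤s (length-filter (_≟SL S) w))
all-S-or-fewer (S ∷ w) with all-S-or-fewer w
... | inj₁ e     = inj₁ (cong (S ∷_) e)
... | inj₂ fewer = inj₂ (s≤s fewer)

disorder-≤ : ∀ c w t → c + length w ≤ suc t → disorder c w ≤ t
disorder-≤ c       []      t _       = z≤n
disorder-≤ c       (L ∷ w) t h       = disorder-≤ (suc c) w t (≤-trans (≤-reflexive (sym (+-suc c _))) h)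
disorder-≤ zero    (S ∷ w) t (s≤s h) = disorder-≤ zero w t (m≤n⇒m≤1+n h)
disorder-≤ (suc c) (S ∷ w) t (s≤s h) = ⊔-lub S-term (disorder-≤ (suc c) w t (m≤n⇒m≤1+n rest))
  where
  rest : suc c + length w ≤ t
  rest = ≤-trans (≤-reflexive (sym (+-suc c _))) h
  S-term : suc c + countS w ≤ t
  S-term = ≤-trans (+-monoʳ-≤ (suc c) (length-filter (_≟SL S) w)) rest

disorder-≤-unless-split : ∀ c w t → c + length w ≤ suc (suc t) →
  (∃[ i ] ∃[ j ] (w ≡ replicate i L ++ replicate j S)) ⊎ disorder c w ≤ t
disorder-≤-unless-split c []      t _ = inj₁ (0 , 0 , refl)
disorder-≤-unless-split c (L ∷ w) t h
  with disorder-≤-unless-split (suc c) w t (≤-trans (≤-reflexive (sym (+-suc c _))) h)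
... | inj₁ (i , j , e) = inj₁ (suc i , j , cong (L ∷_) e)
... | inj₂ small       = inj₂ small
disorder-≤-unless-split zero    (S ∷ w) t (s≤s h) = inj₂ (disorder-≤ zero w t h)
disorder-≤-unless-split (suc c) (S ∷ w) t (s≤s h) with all-S-or-fewer w
... | inj₁ e     = inj₁ (0 , suc (length w) , cong (S ∷_) e)
... | inj₂ fewer = inj₂ (⊔-lub S-term (disorder-≤ (suc c) w t rest))
  where
  rest : suc c + length w ≤ suc t
  rest = ≤-trans (≤-reflexive (sym (+-suc c _))) h
  S-term : suc c + countS w ≤ t
  S-term = ≤-trans (≤-reflexive (sym (+-suc c _))) (≤-trans (+-monoʳ-≤ c fewer) (s≤s⁻¹ rest))

flipGo-↭ : ∀ h rest ys → flipGo h rest ys ↭ h ∷ rest ++ ys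
flipGo-↭ h rest []       = ↭-reflexive (cong (h ∷_) (sym (++-identityʳ rest)))
flipGo-↭ h rest (x ∷ ys) with x <ᵇ h
... | true  = ↭-trans (flipGo-↭ x (h ∷ rest) ys) (↭-sym (shift x (h ∷ rest) ys))
... | false = ++⁺ˡ (h ∷ rest) (flipGo-↭ x [] ys)

flipT-↭ : ∀ xs → flipT xs ↭ xs
flipT-↭ []       = ↭-refl
flipT-↭ (x ∷ xs) = flipGo-↭ x [] xs

flipPow-↭ : ∀ m xs → flipPow m xs ↭ xs
flipPow-↭ zero    xs = ↭-refl
flipPow-↭ (suc m) xs = ↭-trans (flipT-↭ (flipPow m xs)) (flipPow-↭ m xs)

interval : ℕ → ℕ → List ℕ
interval m zero    = []
interval m (suc j) = suc m ∷ interval (suc m) j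

applyUpTo-interval : ∀ (g : ℕ → ℕ) m j → (∀ i → g i ≡ m + i) → map suc (applyUpTo g j) ≡ interval m j
applyUpTo-interval g m zero    _     = refl
applyUpTo-interval g m (suc j) g≡m+ =
  cong₂ _∷_ (cong suc (trans (g≡m+ 0) (+-identityʳ m)))
            (applyUpTo-interval (g ∘ suc) (suc m) j (λ i → trans (g≡m+ (suc i)) (+-suc m i)))

idPerm≡interval : ∀ n → idPerm n ≡ interval 0 n
idPerm≡interval n = applyUpTo-interval (λ i → i) 0 n (λ _ → refl)

interval-++ : ∀ m a b → interval m (a + b) ≡ interval m a ++ interval (a + m) b
interval-++ m zero    b = refl
interval-++ m (suc a) b =
  cong (suc m ∷_) (trans (interval-++ (suc m) a b) (cong (λ d → interval (suc m) a ++ interval d b) (+-suc a m)))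

interval-split : ∀ {k n} → k ≤ n → interval 0 n ≡ interval 0 k ++ interval k (n ∸ k)
interval-split {k} {n} k≤n = begin
  interval 0 n                          ≡⟨ cong (interval 0) (sym (m+[n∸m]≡n k≤n)) ⟩
  interval 0 (k + (n ∸ k))              ≡⟨ interval-++ 0 k (n ∸ k) ⟩
  interval 0 k ++ interval (k + 0) (n ∸ k) ≡⟨ cong (λ d → interval 0 k ++ interval d (n ∸ k)) (+-identityʳ k) ⟩
  interval 0 k ++ interval k (n ∸ k)    ∎
  where open ≡-Reasoning

length-interval : ∀ m j → length (interval m j) ≡ j
length-interval m zero    = refl
length-interval m (suc j) = cong suc (length-interval (suc m) j)

InRange : ℕ → ℕ → Set
InRange n x = 1 ≤ x × x ≤ n

interval-in-range : ∀ m j n → m + j ≤ n → All (InRange n) (interval m j)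
interval-in-range m zero    n _   = []
interval-in-range m (suc j) n m+j<n =
  (s≤s z≤n , ≤-trans (s≤s (m≤m+n m j)) m+j<n') ∷ interval-in-range (suc m) j n m+j<n'
  where
  m+j<n' : suc m + j ≤ n
  m+j<n' = ≤-trans (≤-reflexive (sym (+-suc m j))) m+j<n

interval-> : ∀ m j {k} → k ≤ m → All (k <_) (interval m j)
interval-> m zero    _   = []
interval-> m (suc j) k≤m = s≤s k≤m ∷ interval-> (suc m) j (m≤n⇒m≤1+n k≤m)

interval-∸ : ∀ m j k → map (_∸ k) (interval (m + k) j) ≡ interval m j
interval-∸ m zero    k = refl
interval-∸ m (suc j) k = cong₂ _∷_ (m+n∸n≡m (suc m) k) (interval-∸ (suc m) j k)

perm-in-range : ∀ {n xs} → IsPerm n xs → All (InRange n) xs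
perm-in-range {n} p =
  All-resp-↭ (↭-sym p) (subst (All (InRange n)) (sym (idPerm≡interval n)) (interval-in-range 0 n n ≤-refl))

length-perm : ∀ {n xs} → IsPerm n xs → length xs ≡ n
length-perm {n} p = trans (↭-length p) (trans (cong length (idPerm≡interval n)) (length-interval 0 n))

shadow-small : ∀ {k} xs → All (_≤ k) xs → shadow k xs ≡ replicate (length xs) S
shadow-small []       []           = refl
shadow-small (x ∷ xs) (x≤k ∷ small) = cong₂ _∷_ (letter-S x≤k) (shadow-small xs small)

shadow-large : ∀ {k} xs → All (k <_) xs → shadow k xs ≡ replicate (length xs) L
shadow-large []       []           = refl
shadow-large (x ∷ xs) (k<x ∷ large) = cong₂ _∷_ (letter-L k<x) (shadow-large xs large)

letter≡S⇒≤ : ∀ {k} x → letter k x ≡ S → x ≤ k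
letter≡S⇒≤ {k} x e with x ≤ᵇ k | ≤ᵇ-reflects-≤ x k
... | true  | ofʸ x≤k = x≤k
... | false | _        = ⊥-elim (S≢L (sym e))

letter≡L⇒> : ∀ {k} x → letter k x ≡ L → k < x
letter≡L⇒> {k} x e with x ≤ᵇ k | ≤ᵇ-reflects-≤ x k
... | true  | _        = ⊥-elim (S≢L e)
... | false | ofⁿ x≰k = ≰⇒> x≰k

shadow≡Ss⇒small : ∀ {k} xs j → shadow k xs ≡ replicate j S → All (_≤ k) xs
shadow≡Ss⇒small []       j       _ = []
shadow≡Ss⇒small (x ∷ xs) (suc j) e = letter≡S⇒≤ x (∷-injectiveˡ e) ∷ shadow≡Ss⇒small xs j (∷-injectiveʳ e)

shadow≡Ls⇒large : ∀ {k} xs j → shadow k xs ≡ replicate j L → All (k <_) xs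
shadow≡Ls⇒large []       j       _ = []
shadow≡Ls⇒large (x ∷ xs) (suc j) e = letter≡L⇒> x (∷-injectiveˡ e) ∷ shadow≡Ls⇒large xs j (∷-injectiveʳ e)

shadow-idPerm : ∀ {k n} → k ≤ n → shadow k (idPerm n) ≡ replicate k S ++ replicate (n ∸ k) L
shadow-idPerm {k} {n} k≤n = begin
  shadow k (idPerm n)                                       ≡⟨ cong (shadow k) (trans (idPerm≡interval n) (interval-split k≤n)) ⟩
  shadow k (interval 0 k ++ interval k (n ∸ k))             ≡⟨ map-++ _ (interval 0 k) _ ⟩
  shadow k (interval 0 k) ++ shadow k (interval k (n ∸ k))  ≡⟨ cong₂ _++_ small large ⟩
  replicate k S ++ replicate (n ∸ k) L                      ∎
  where
  open ≡-Reasoning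
  small : shadow k (interval 0 k) ≡ replicate k S
  small = trans (shadow-small _ (All.map proj₂ (interval-in-range 0 k k ≤-refl)))
                (cong (λ j → replicate j S) (length-interval 0 k))
  large : shadow k (interval k (n ∸ k)) ≡ replicate (n ∸ k) L
  large = trans (shadow-large _ (interval-> k (n ∸ k) ≤-refl))
                (cong (λ j → replicate j L) (length-interval k (n ∸ k)))

shadow-perm : ∀ {n k xs} → IsPerm n xs → k ≤ n → shadow k xs ↭ replicate k S ++ replicate (n ∸ k) L
shadow-perm p k≤n = ↭-trans (map⁺ _ p) (↭-reflexive (shadow-idPerm k≤n))

disorder-zero⇒shadow-sorted : ∀ {n k τ} → IsPerm n τ → k ≤ n → disorder 0 (shadow k τ) ≡ 0 →
  shadow k τ ≡ replicate k S ++ replicate (n ∸ k) L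
disorder-zero⇒shadow-sorted {n} {k} {τ} p k≤n e with disorder-zero⇒sorted (shadow k τ) e
... | i , j , sorted with sorted-word-determined {i} {j} {k} {n ∸ k} (↭-trans (↭-reflexive (sym sorted)) (shadow-perm p k≤n))
...   | refl , refl = sorted

shadow-split-or-small : ∀ {n k π} t → IsPerm n π → k ≤ n → n ≤ suc (suc t) →
  shadow k π ≡ replicate (n ∸ k) L ++ replicate k S ⊎ disorder 0 (shadow k π) ≤ t
shadow-split-or-small {n} {k} {π} t p k≤n n≤t+2
  with disorder-≤-unless-split 0 (shadow k π) t
         (≤-trans (≤-reflexive (trans (length-map _ π) (length-perm p))) n≤t+2)
... | inj₂ small = inj₂ small
... | inj₁ (i , j , split)
  with sorted-word-determined {j} {i} {k} {n ∸ k} (↭-trans (++-comm (replicate j S) (replicate i L))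
                                (↭-trans (↭-reflexive (sym split)) (shadow-perm p k≤n)))
...   | refl , refl = inj₁ split

unsorted-after-passes⇒split : ∀ {n k π} m → IsPerm n π → k ≤ n → n ≤ suc (suc m) →
  ¬ (shadow k (flipPow m π) ≡ replicate k S ++ replicate (n ∸ k) L) →
  shadow k π ≡ replicate (n ∸ k) L ++ replicate k S
unsorted-after-passes⇒split {n} {k} {π} m p k≤n n≤m+2 unsorted
  with shadow-split-or-small m p k≤n n≤m+2
... | inj₁ split = split
... | inj₂ small = ⊥-elim (unsorted (disorder-zero⇒shadow-sorted (↭-trans (flipPow-↭ m π) p) k≤n sorted))
  where
  sorted : disorder 0 (shadow k (flipPow m π)) ≡ 0
  sorted = n≤0⇒n≡0 (begin
    disorder 0 (shadow k (flipPow m π))  ≤⟨ disorder-flipPow k m π ⟩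
    disorder 0 (shadow k π) ∸ m          ≤⟨ ∸-monoˡ-≤ m small ⟩
    m ∸ m                                ≡⟨ n∸n≡0 m ⟩
    0                                    ∎)
    where open ≤-Reasoning

↭-partition : ∀ {A : Set} {P : A → Set} (P? : Decidable P) {xs ys us vs : List A} →
  All P xs → All (∁ P) ys → All P us → All (∁ P) vs → xs ++ ys ↭ us ++ vs → xs ↭ us × ys ↭ vs
↭-partition {A} {P} P? {xs} {ys} {us} {vs} Pxs ¬Pys Pus ¬Pvs p =
    ↭-trans (↭-reflexive (sym (filter-left P? Pxs ¬Pys)))
            (↭-trans (filter-↭ P? p) (↭-reflexive (filter-left P? Pus ¬Pvs)))
  , ↭-trans (↭-reflexive (sym (filter-right (¬? ∘ P?) (All.map ¬¬ Pxs) ¬Pys)))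
            (↭-trans (filter-↭ (¬? ∘ P?) p) (↭-reflexive (filter-right (¬? ∘ P?) (All.map ¬¬ Pus) ¬Pvs)))
  where
  ¬¬ : ∀ {x} → P x → ¬ ¬ P x
  ¬¬ px ¬px = ¬px px
  filter-left : ∀ {Q : A → Set} (Q? : Decidable Q) {as bs} → All Q as → All (∁ Q) bs → filter Q? (as ++ bs) ≡ as
  filter-left Q? {as} {bs} Qas ¬Qbs =
    trans (filter-++ Q? as bs) (trans (cong₂ _++_ (filter-all Q? Qas) (filter-none Q? ¬Qbs)) (++-identityʳ as))
  filter-right : ∀ {Q : A → Set} (Q? : Decidable Q) {as bs} → All (∁ Q) as → All Q bs → filter Q? (as ++ bs) ≡ bs
  filter-right Q? {as} {bs} ¬Qas Qbs =
    trans (filter-++ Q? as bs) (cong₂ _++_ (filter-none Q? ¬Qas) (filter-all Q? Qbs))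

map-≡-++ : ∀ {A B : Set} (f : A → B) xs u v → map f xs ≡ u ++ v →
  ∃[ ys ] ∃[ zs ] (xs ≡ ys ++ zs × map f ys ≡ u × map f zs ≡ v)
map-≡-++ f xs       []      v e = [] , xs , refl , refl , e
map-≡-++ f []       (_ ∷ _) v ()
map-≡-++ f (x ∷ xs) (_ ∷ u) v e with map-≡-++ f xs u v (∷-injectiveʳ e)
... | ys , zs , xs≡ , eys , ezs = x ∷ ys , zs , cong (x ∷_) xs≡ , cong₂ _∷_ (∷-injectiveˡ e) eys , ezs

split-shadow⇒skewSum : ∀ {n k π} → k ≤ n → IsPerm n π → shadow k π ≡ replicate (n ∸ k) L ++ replicate k S →
  ∃[ σ ] ∃[ σ' ] (IsPerm (n ∸ k) σ × IsPerm k σ' × π ≡ skewSum σ k σ')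
split-shadow⇒skewSum {n} {k} {π} k≤n p split with map-≡-++ _ π _ _ split
... | A , B , π≡A++B , shadowA , shadowB = map (_∸ k) A , B , A-perm , proj₂ parts , π≡skewSum
  where
  large : All (k <_) A
  large = shadow≡Ls⇒large A (n ∸ k) shadowA
  small : All (_≤ k) B
  small = shadow≡Ss⇒small B k shadowB
  parts : A ↭ interval k (n ∸ k) × B ↭ idPerm k
  parts = ↭-partition (k <?_) large (All.map ≤⇒≯ small) (interval-> k (n ∸ k) ≤-refl)
            (All.map (≤⇒≯ ∘ proj₂) (subst (All (InRange k)) (sym (idPerm≡interval k)) (interval-in-range 0 k k ≤-refl)))
            (begin
              A ++ B                              ≡⟨ π≡A++B ⟨
              π                                   ↭⟨ p ⟩
              idPerm n                            ≡⟨ trans (idPerm≡interval n) (interval-split k≤n) ⟩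
              interval 0 k ++ interval k (n ∸ k)  ↭⟨ ++-comm (interval 0 k) _ ⟩
              interval k (n ∸ k) ++ interval 0 k  ≡⟨ cong (interval k (n ∸ k) ++_) (sym (idPerm≡interval k)) ⟩
              interval k (n ∸ k) ++ idPerm k      ∎)
    where open PermutationReasoning
  A-perm : map (_∸ k) A ↭ idPerm (n ∸ k)
  A-perm = ↭-trans (map⁺ (_∸ k) (proj₁ parts))
                   (↭-reflexive (trans (interval-∸ 0 (n ∸ k) k) (sym (idPerm≡interval (n ∸ k)))))
  π≡skewSum : π ≡ map (_+ k) (map (_∸ k) A) ++ B
  π≡skewSum = trans π≡A++B (cong (_++ B) (sym (trans (sym (map-∘ A))
                (map-id-local (All.map (λ k<x → m∸n+n≡m (<⇒≤ k<x)) large)))))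

letters-separate : ∀ {x y} → x < y → letter x x ≢ letter x y
letters-separate {x} x<y e = S≢L (trans (sym (letter-S {x} {x} ≤-refl)) (trans e (letter-L x<y)))

-- Two lists of entries in 1..n with the same k-shadows for 1 ≤ k ≤ n − 1 are
-- equal: at the first difference x < y, the x-shadows differ.
shadows-determine : ∀ n u v → All (InRange n) u → All (InRange n) v → length u ≡ length v →
  (∀ k → 1 ≤ k → k ≤ n ∸ 1 → shadow k u ≡ shadow k v) → u ≡ v
shadows-determine n []      []      _ _ _ _ = refl
shadows-determine n []      (_ ∷ _) _ _ () _
shadows-determine n (_ ∷ _) []      _ _ () _
shadows-determine n (x ∷ u) (y ∷ v) ((1≤x , x≤n) ∷ u-range) ((1≤y , y≤n) ∷ v-range) len same
  with <-cmp x y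
... | tri< x<y _ _ = ⊥-elim (letters-separate x<y
                       (∷-injectiveˡ (same x 1≤x (∸-monoˡ-≤ 1 (≤-trans x<y y≤n)))))
... | tri> _ _ y<x = ⊥-elim (letters-separate y<x
                       (sym (∷-injectiveˡ (same y 1≤y (∸-monoˡ-≤ 1 (≤-trans y<x x≤n))))))
... | tri≈ _ refl _ = cong (x ∷_) (shadows-determine n u v u-range v-range (suc-injective len)
                                     (λ k 1≤k k≤n-1 → ∷-injectiveʳ (same k 1≤k k≤n-1)))

sorted-shadows⇒identity : ∀ {n τ} → IsPerm n τ →
  (∀ k → 1 ≤ k → k ≤ n ∸ 1 → shadow k τ ≡ replicate k S ++ replicate (n ∸ k) L) → τ ≡ idPerm n
sorted-shadows⇒identity {n} {τ} p sorted =
  shadows-determine n τ (idPerm n) (perm-in-range p) (perm-in-range ↭-refl) (↭-length p)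
    (λ k 1≤k k≤n-1 → trans (sorted k 1≤k k≤n-1) (sym (shadow-idPerm (≤-trans k≤n-1 (m∸n≤m n 1)))))

counterexample-or-all : ∀ {P : ℕ → Set} → (∀ k → Dec (P k)) → ∀ m →
  (∃[ k ] (1 ≤ k × k ≤ m × ¬ P k)) ⊎ (∀ k → 1 ≤ k → k ≤ m → P k)
counterexample-or-all {P} P? m with anyUpTo? (λ j → ¬? (P? (suc j))) m
... | yes (j , j<m , ¬Pj) = inj₁ (suc j , s≤s z≤n , j<m , ¬Pj)
... | no none             = inj₂ holds
  where
  holds : ∀ k → 1 ≤ k → k ≤ m → P k
  holds (suc j) _ j<m = decidable-stable (P? (suc j)) (λ ¬Pj → none (j , j<m , ¬Pj))

some-shadow-unsorted : ∀ {n τ} → IsPerm n τ → ¬ τ ≡ idPerm n →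
  ∃[ k ] (1 ≤ k × k ≤ n ∸ 1 × ¬ (shadow k τ ≡ replicate k S ++ replicate (n ∸ k) L))
some-shadow-unsorted {n} {τ} p τ≢id
  with counterexample-or-all (λ k → ≡-dec _≟SL_ (shadow k τ) (replicate k S ++ replicate (n ∸ k) L)) (n ∸ 1)
... | inj₁ unsorted   = unsorted
... | inj₂ all-sorted = ⊥-elim (τ≢id (sorted-shadows⇒identity p all-sorted))

-- The theorem.  With n = m + 2 and τ = T^m(π): τ ≠ id because cost(π) = m + 1,
-- which gives (1); part (2) needs only that π is a permutation.
proposition28 : (n : ℕ) → 2 ≤ n → (π : List ℕ) → IsPerm n π → HasCost n π (n ∸ 1) →
    (∃[ k ] (1 ≤ k × k ≤ n ∸ 1 ×
        ¬ (shadow k (flipPow (n ∸ 2) π) ≡ replicate k S ++ replicate (n ∸ k) L)))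
    × (∀ k → 1 ≤ k → k ≤ n ∸ 1 →
        ¬ (shadow k (flipPow (n ∸ 2) π) ≡ replicate k S ++ replicate (n ∸ k) L) →
        (shadow k π ≡ replicate (n ∸ k) L ++ replicate k S)
        × (∃[ σ ] ∃[ σ' ] (IsPerm (n ∸ k) σ × IsPerm k σ' × π ≡ skewSum σ k σ')))
proposition28 zero          ()       _ _ _
proposition28 (suc zero)    (s≤s ()) _ _ _
proposition28 (suc (suc m)) _ π π-perm (_ , not-id-earlier) =
    some-shadow-unsorted τ-perm (not-id-earlier m (n<1+n m))
  , λ k _ k≤n-1 unsorted →
      let k≤n   = m≤n⇒m≤1+n k≤n-1
          split = unsorted-after-passes⇒split m π-perm k≤n ≤-refl unsorted
      in split , split-shadow⇒skewSum k≤n π-perm split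
  where
  τ-perm : IsPerm (suc (suc m)) (flipPow m π)
  τ-perm = ↭-trans (flipPow-↭ m π) π-perm
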